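{- Let $x\in{}^\omega(\omega\setminus\{0\})$ be strictly increasing and for each $n\in\omega$ let $T_n$ be an $x$-squeezed tree. Then there are an $x$-squeezed tree $T^*$ and an increasing sequence of integers $\langle\gamma_t: t\in\omega\rangle$ with $\gamma_0=0$ and $t<\gamma_t$ for all $t>0$, such that for every $f\in{}^{<\omega}\omega$: $f\in T^*$ if and only if for every $t>0$ there is $s<t$ with $f\restriction\gamma_t\in T_{\gamma_s}$.
   Context: For $f\in{}^{<\omega}\omega$, $f\restriction\gamma$ is $f$ itself if $\gamma\ge\mathrm{lh}(f)$. Trees are subsets of ${}^{<\omega}\omega$ closed under initial segments. For $x$ strictly increasing and $n\in\omega$, $(j,k,m)$ is an $x$-bound system above $n$ iff $k\in\omega$, $j,m$ are functions from $\{0,\dots,k\}$ into $\omega$, $j(0)>x(n+m(0)+1)$, and for all $l<k$, $j(l+1)>x(j(l)+m(l+1)+1)$. A tree $T$ is $(j,k,m,\eta)$-squeezed iff $T$ has no terminal nodes, $\mathrm{dom}(\eta)=\{(l,t): l\le k,\ t\le m(l)\}$, $\eta(l,t)\in{}^{j(l)}\omega$, and every $\nu\in T$ is comparable (one is an initial segment of the other) with some $\eta(l,t)$. $T$ is $x$-squeezed iff for every $n$ there is an $x$-bound system $(j,k,m)$ above $n$ and $\eta$ with $T$ $(j,k,m,\eta)$-squeezed. -}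

module Defs where

open import Level using (0ℓ)
open import Data.Nat using (ℕ; zero; suc; _+_; _<_; _≤_)
open import Data.Fin using (Fin; inject₁) renaming (zero to fzero; suc to fsuc)
open import Data.List using (List; take; length; _++_; [_])
open import Data.Product using (Σ; ∃; ∃-syntax; _×_)
open import Data.Sum using (_⊎_)
open import Relation.Unary using (Pred; _∈_)
open import Relation.Binary.PropositionalEquality using (_≡_)

Seq : Set
Seq = List ℕ

-- f ↾ γ ; equals f itself when γ ≥ lh(f)
_↾_ : Seq → ℕ → Seq
f ↾ γ = take γ f

_⊑_ : Seq → Seq → Set
f ⊑ g = ∃[ h ] (f ++ h ≡ g)

Comparable : Seq → Seq → Set
Comparable f g = f ⊑ g ⊎ g ⊑ f

SeqSet : Set₁
SeqSet = Pred Seq 0ℓ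

IsTree : SeqSet → Set
IsTree T = ∀ f g → g ⊑ f → f ∈ T → g ∈ T

NoTerminalNodes : SeqSet → Set
NoTerminalNodes T = ∀ ν → ν ∈ T → ∃[ a ] (ν ++ [ a ] ∈ T)

StrictlyIncreasing : (ℕ → ℕ) → Set
StrictlyIncreasing x = ∀ n → x n < x (suc n)

record BoundSystem (x : ℕ → ℕ) (n : ℕ) : Set where
  field
    k : ℕ
    j : Fin (suc k) → ℕ
    m : Fin (suc k) → ℕ
    first : x (n + m fzero + 1) < j fzero
    step  : (l : Fin k) → x (j (inject₁ l) + m (fsuc l) + 1) < j (fsuc l)

Squeezed : ∀ {x n} → BoundSystem x n → SeqSet → Set
Squeezed B T =
  Σ ((l : Fin (suc k)) → Fin (suc (m l)) → Seq) λ η →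
    ((l : Fin (suc k)) (t : Fin (suc (m l))) → length (η l t) ≡ j l)
    × NoTerminalNodes T
    × (∀ ν → ν ∈ T → ∃[ l ] ∃[ t ] Comparable ν (η l t))
  where open BoundSystem B

XSqueezed : (ℕ → ℕ) → SeqSet → Set
XSqueezed x T = ∀ n → Σ (BoundSystem x n) λ B → Squeezed B T

module Submission where

open import Defs
open import Data.Nat using (ℕ; zero; suc; _<_; _+_; _≤_; _≤?_; z≤n; s≤s)
open import Data.Nat.Properties
open import Data.Fin using (Fin; inject₁) renaming (zero to fzero; suc to fsuc)
open import Data.List using ([]; _∷_; take; drop; length; _++_; [_])
open import Data.List.Properties using (take-all; take++drop≡id; ++-assoc; length-++)
open import Data.Product using (Σ; ∃; ∃-syntax; _×_; _,_; -,_; proj₁; proj₂; map₁; map₂)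
open import Data.Sum using (inj₁; inj₂)
open import Function using (id)
open import Relation.Nullary using (yes; no)
open import Relation.Unary using (_∈_)
open import Relation.Binary.PropositionalEquality using (_≡_; refl; sym; trans; cong; subst)
open import Function.Bundles using (_⇔_; mk⇔)

-- T* is defined to be exactly the right-hand side of the equivalence, so the
-- work is to choose γ so that T* is an x-squeezed tree.  Above a given n,
-- concatenate squeezings of T 0, T 1, …, T (γ n), each one above the last
-- level of the previous one: the concatenation is again a bound system
-- above n.  A node ν of T* has ν ↾ γ (n + 1) in some T (γ s) with s ≤ n,
-- so it is comparable with a node of that concatenation; choosing
-- γ (n + 1) beyond every level in it makes ν itself comparable with that
-- node.

∷-⊑ : ∀ a {f g} → f ⊑ g → (a ∷ f) ⊑ (a ∷ g)
∷-⊑ a (h , p) = h , cong (a ∷_) p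

⊑-trans : ∀ {f g h} → f ⊑ g → g ⊑ h → f ⊑ h
⊑-trans {f} (h₁ , refl) (h₂ , refl) = h₁ ++ h₂ , sym (++-assoc f h₁ h₂)

take-⊑ : ∀ n f → take n f ⊑ f
take-⊑ n f = drop n f , take++drop≡id n f

take-mono-⊑ : ∀ n {f g} → g ⊑ f → take n g ⊑ take n f
take-mono-⊑ zero _ = [] , refl
take-mono-⊑ (suc n) {f} {[]} _ = take (suc n) f , refl
take-mono-⊑ (suc n) {g = a ∷ g} (h , refl) = ∷-⊑ a (take-mono-⊑ n (h , refl))

take-++ˡ : ∀ n (f g : Seq) → n ≤ length f → take n (f ++ g) ≡ take n f
take-++ˡ zero f g _ = refl
take-++ˡ (suc n) (a ∷ f) g (s≤s n≤∣f∣) = cong (a ∷_) (take-++ˡ n f g n≤∣f∣)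

take-⊑-comparable : ∀ n ν e → length e ≤ n → take n ν ⊑ e → Comparable ν e
take-⊑-comparable n [] e _ _ = inj₁ (e , refl)
take-⊑-comparable zero (a ∷ ν) [] _ _ = inj₂ (a ∷ ν , refl)
take-⊑-comparable (suc n) (a ∷ ν) [] _ (_ , ())
take-⊑-comparable (suc n) (a ∷ ν) (.a ∷ e) (s≤s ∣e∣≤n) (h , refl)
  with take-⊑-comparable n ν e ∣e∣≤n (h , refl)
... | inj₁ ν⊑e = inj₁ (∷-⊑ a ν⊑e)
... | inj₂ e⊑ν = inj₂ (∷-⊑ a e⊑ν)

take-comparable : ∀ n ν e → length e ≤ n → Comparable (take n ν) e → Comparable ν e
take-comparable n ν e ∣e∣≤n (inj₁ ν↾⊑e) = take-⊑-comparable n ν e ∣e∣≤n ν↾⊑e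
take-comparable n ν e _ (inj₂ e⊑ν↾) = inj₂ (⊑-trans e⊑ν↾ (take-⊑ n ν))

module _ {γ : ℕ → ℕ} (γ-increasing : StrictlyIncreasing γ) where

  increasing⇒<-mono : ∀ {s t} → s < t → γ s < γ t
  increasing⇒<-mono {s} {suc t} s<1+t with m<1+n⇒m<n∨m≡n s<1+t
  ... | inj₁ s<t = <-trans (increasing⇒<-mono s<t) (γ-increasing t)
  ... | inj₂ refl = γ-increasing s

  increasing⇒≤-mono : ∀ {s t} → s ≤ t → γ s ≤ γ t
  increasing⇒≤-mono s≤t with m≤n⇒m<n∨m≡n s≤t
  ... | inj₁ s<t = <⇒≤ (increasing⇒<-mono s<t)
  ... | inj₂ refl = ≤-refl

  increasing⇒<-cancel : ∀ {s t} → γ s < γ t → s < t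
  increasing⇒<-cancel γs<γt = ≰⇒> (λ t≤s → <⇒≱ γs<γt (increasing⇒≤-mono t≤s))

  increasing-bracket : γ 0 ≡ 0 → ∀ L → ∃[ t ] (γ t ≤ L × L < γ (suc t))
  increasing-bracket γ0≡0 zero = 0 , ≤-reflexive γ0≡0 , subst (_< γ 1) γ0≡0 (γ-increasing 0)
  increasing-bracket γ0≡0 (suc L) with increasing-bracket γ0≡0 L
  ... | t , γt≤L , L<γ[1+t] with suc L <? γ (suc t)
  ...   | yes 1+L<γ[1+t] = t , m≤n⇒m≤1+n γt≤L , 1+L<γ[1+t]
  ...   | no 1+L≮γ[1+t] = suc t , ≮⇒≥ 1+L≮γ[1+t] , ≤-<-trans L<γ[1+t] (γ-increasing (suc t))

squeezed⇒noTerminalNodes : ∀ {x T} → XSqueezed x T → NoTerminalNodes T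
squeezed⇒noTerminalNodes squeezed = proj₁ (proj₂ (proj₂ (proj₂ (squeezed 0))))

-- A bound system above n together with its η, stored block by block: the
-- block of index l carries j l, m l and η l, and lives above the level of
-- the previous block (above n for the first one).
module Chains (x : ℕ → ℕ) where

  record Block (n : ℕ) : Set where
    field
      j m : ℕ
      above : x (n + m + 1) < j
      η : Fin (suc m) → Seq
      η-length : ∀ t → length (η t) ≡ j

  data Chain : ℕ → Set where
    ⟨_⟩ : ∀ {n} → Block n → Chain n
    _∷_ : ∀ {n} (b : Block n) → Chain (Block.j b) → Chain n

  top : ∀ {n} → Chain n → ℕ
  top ⟨ b ⟩ = Block.j b
  top (b ∷ C) = top C

  _++ᶜ_ : ∀ {n} (C : Chain n) → Chain (top C) → Chain n
  ⟨ b ⟩ ++ᶜ D = b ∷ D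
  (b ∷ C) ++ᶜ D = b ∷ (C ++ᶜ D)

  span : ∀ {n} → Chain n → ℕ
  span ⟨ b ⟩ = Block.j b
  span (b ∷ C) = Block.j b + span C

  depth : ∀ {n} → Chain n → ℕ
  depth ⟨ _ ⟩ = 0
  depth (_ ∷ C) = suc (depth C)

  blockAt : ∀ {n} (C : Chain n) → Fin (suc (depth C)) → ∃ Block
  blockAt ⟨ b ⟩ _ = -, b
  blockAt (b ∷ C) fzero = -, b
  blockAt (b ∷ C) (fsuc l) = blockAt C l

  ηAt : ∀ {n} (C : Chain n) (l : Fin (suc (depth C))) →
        Fin (suc (Block.m (proj₂ (blockAt C l)))) → Seq
  ηAt C l = Block.η (proj₂ (blockAt C l))

  _∈ᶜ_ : ∀ {n} → Seq → Chain n → Set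
  e ∈ᶜ C = ∃[ l ] ∃[ t ] ηAt C l t ≡ e

  ∈ᶜ-∷ : ∀ {n e} (b : Block n) {C : Chain (Block.j b)} → e ∈ᶜ C → e ∈ᶜ (b ∷ C)
  ∈ᶜ-∷ b (l , e∈C) = fsuc l , e∈C

  ∈ᶜ-++ˡ : ∀ {n e} (C : Chain n) (D : Chain (top C)) → e ∈ᶜ C → e ∈ᶜ (C ++ᶜ D)
  ∈ᶜ-++ˡ ⟨ b ⟩ D (fzero , e∈b) = fzero , e∈b
  ∈ᶜ-++ˡ (b ∷ C) D (fzero , e∈b) = fzero , e∈b
  ∈ᶜ-++ˡ (b ∷ C) D (fsuc l , e∈C) = ∈ᶜ-∷ b (∈ᶜ-++ˡ C D (l , e∈C))

  ∈ᶜ-++ʳ : ∀ {n e} (C : Chain n) (D : Chain (top C)) → e ∈ᶜ D → e ∈ᶜ (C ++ᶜ D)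
  ∈ᶜ-++ʳ ⟨ b ⟩ D e∈D = ∈ᶜ-∷ b e∈D
  ∈ᶜ-++ʳ (b ∷ C) D e∈D = ∈ᶜ-∷ b (∈ᶜ-++ʳ C D e∈D)

  ∈ᶜ⇒length≤span : ∀ {n e} (C : Chain n) → e ∈ᶜ C → length e ≤ span C
  ∈ᶜ⇒length≤span ⟨ b ⟩ (_ , t , refl) = ≤-reflexive (Block.η-length b t)
  ∈ᶜ⇒length≤span (b ∷ C) (fzero , t , refl) =
    ≤-trans (≤-reflexive (Block.η-length b t)) (m≤m+n _ (span C))
  ∈ᶜ⇒length≤span (b ∷ C) (fsuc l , e∈C) =
    ≤-trans (∈ᶜ⇒length≤span C (l , e∈C)) (m≤n+m _ (Block.j b))

  Covers : ∀ {n} → Chain n → SeqSet → Set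
  Covers C T = ∀ ν → ν ∈ T → ∃[ e ] (e ∈ᶜ C × Comparable ν e)

  Covers-++ˡ : ∀ {n T} (C : Chain n) (D : Chain (top C)) → Covers C T → Covers (C ++ᶜ D) T
  Covers-++ˡ C D covers ν ν∈T = map₂ (map₁ (∈ᶜ-++ˡ C D)) (covers ν ν∈T)

  Covers-++ʳ : ∀ {n T} (C : Chain n) (D : Chain (top C)) → Covers D T → Covers (C ++ᶜ D) T
  Covers-++ʳ C D covers ν ν∈T = map₂ (map₁ (∈ᶜ-++ʳ C D)) (covers ν ν∈T)

  boundSystem : ∀ {n} → Chain n → BoundSystem x n
  BoundSystem.k (boundSystem C) = depth C
  BoundSystem.j (boundSystem C) l = Block.j (proj₂ (blockAt C l))
  BoundSystem.m (boundSystem C) l = Block.m (proj₂ (blockAt C l))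
  BoundSystem.first (boundSystem ⟨ b ⟩) = Block.above b
  BoundSystem.first (boundSystem (b ∷ C)) = Block.above b
  BoundSystem.step (boundSystem (b ∷ C)) fzero = BoundSystem.first (boundSystem C)
  BoundSystem.step (boundSystem (b ∷ C)) (fsuc l) = BoundSystem.step (boundSystem C) l

  chain⇒squeezed : ∀ {n T} (C : Chain n) → NoTerminalNodes T → Covers C T →
                   Σ (BoundSystem x n) λ B → Squeezed B T
  chain⇒squeezed {T = T} C noTerminal covers =
    boundSystem C , ηAt C , (λ l → Block.η-length (proj₂ (blockAt C l))) , noTerminal , covered
    where
    covered : ∀ ν → ν ∈ T → ∃[ l ] ∃[ t ] Comparable ν (ηAt C l t)
    covered ν ν∈T with covers ν ν∈T
    ... | _ , (l , t , refl) , ν~e = l , t , ν~e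

  headBlock : ∀ {n k} (j m : Fin (suc k) → ℕ) → x (n + m fzero + 1) < j fzero →
              (η : ∀ l → Fin (suc (m l)) → Seq) → (∀ l t → length (η l t) ≡ j l) → Block n
  headBlock j m above η η-length =
    record { above = above ; η = η fzero ; η-length = η-length fzero }

  chainOf : ∀ {n} k (j m : Fin (suc k) → ℕ) → x (n + m fzero + 1) < j fzero →
            (∀ l → x (j (inject₁ l) + m (fsuc l) + 1) < j (fsuc l)) →
            (η : ∀ l → Fin (suc (m l)) → Seq) → (∀ l t → length (η l t) ≡ j l) → Chain n
  chainOf zero j m first step η η-length = ⟨ headBlock j m first η η-length ⟩
  chainOf (suc k) j m first step η η-length =
    headBlock j m first η η-length
    ∷ chainOf k (λ l → j (fsuc l)) (λ l → m (fsuc l)) (step fzero) (λ l → step (fsuc l))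
                (λ l → η (fsuc l)) (λ l → η-length (fsuc l))

  chainOf-∈ᶜ : ∀ {n} k j m first step η η-length l t →
               η l t ∈ᶜ chainOf {n} k j m first step η η-length
  chainOf-∈ᶜ zero j m first step η η-length fzero t = fzero , t , refl
  chainOf-∈ᶜ (suc k) j m first step η η-length fzero t = fzero , t , refl
  chainOf-∈ᶜ (suc k) j m first step η η-length (fsuc l) t =
    ∈ᶜ-∷ (headBlock j m first η η-length)
         (chainOf-∈ᶜ k _ _ (step fzero) _ _ _ l t)

  squeezed⇒chain : ∀ {n T} → Σ (BoundSystem x n) (λ B → Squeezed B T) →
                   Σ (Chain n) λ C → Covers C T
  squeezed⇒chain {T = T} (B , η , η-length , _ , covered) =
    chainOf k j m first step η η-length , covers
    where
    open BoundSystem B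
    covers : Covers (chainOf k j m first step η η-length) T
    covers ν ν∈T with covered ν ν∈T
    ... | l , t , ν~e = η l t , chainOf-∈ᶜ k j m first step η η-length l t , ν~e

module Construction (x : ℕ → ℕ) (T : ℕ → SeqSet)
                    (T-tree : ∀ n → IsTree (T n)) (T-squeezed : ∀ n → XSqueezed x (T n)) where

  open Chains x

  chainUpTo : ∀ n → ℕ → Chain n
  chainUpTo n zero = proj₁ (squeezed⇒chain (T-squeezed 0 n))
  chainUpTo n (suc c) = C ++ᶜ proj₁ (squeezed⇒chain (T-squeezed (suc c) (top C)))
    where C = chainUpTo n c

  chainUpTo-covers : ∀ n {c i} → i ≤ c → Covers (chainUpTo n c) (T i)
  chainUpTo-covers n {zero} z≤n = proj₂ (squeezed⇒chain (T-squeezed 0 n))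
  chainUpTo-covers n {suc c} i≤1+c with m≤n⇒m<n∨m≡n i≤1+c
  ... | inj₁ (s≤s i≤c) = Covers-++ˡ (chainUpTo n c) _ (chainUpTo-covers n i≤c)
  ... | inj₂ refl = Covers-++ʳ (chainUpTo n c) _ (proj₂ (squeezed⇒chain (T-squeezed (suc c) _)))

  γ : ℕ → ℕ
  γ zero = 0
  γ (suc t) = 2 + γ t + span (chainUpTo t (γ t))

  γ-increasing : StrictlyIncreasing γ
  γ-increasing t = ≤-trans (m≤m+n (suc (γ t)) _) (n≤1+n _)

  γ-inflationary : ∀ t → t ≤ γ t
  γ-inflationary zero = z≤n
  γ-inflationary (suc t) = ≤-trans (s≤s (γ-inflationary t)) (γ-increasing t)

  γ-above : ∀ t → 0 < t → t < γ t
  γ-above (suc t) _ = s≤s (s≤s (≤-trans (γ-inflationary t) (m≤m+n _ _)))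

  span≤γ : ∀ n → span (chainUpTo n (γ n)) ≤ γ (suc n)
  span≤γ n = m≤n+m _ (2 + γ n)

  T* : SeqSet
  T* f = ∀ t → 0 < t → ∃[ s ] (s < t × (f ↾ γ t) ∈ T (γ s))

  T*-tree : IsTree T*
  T*-tree f g g⊑f f∈T* t t>0 with f∈T* t t>0
  ... | s , s<t , f↾∈T = s , s<t , T-tree (γ s) _ _ (take-mono-⊑ (γ t) g⊑f) f↾∈T

  -- Levels γ t ≤ ∣ν∣ only see ν; any longer level has t > t₀ ≥ s₀.
  T*-extend : ∀ {ν a t₀ s₀} → ν ∈ T* → γ t₀ ≤ length ν → s₀ ≤ t₀ →
              ν ++ [ a ] ∈ T (γ s₀) → ν ++ [ a ] ∈ T*
  T*-extend {ν} {a} {t₀} {s₀} ν∈T* γt₀≤∣ν∣ s₀≤t₀ νa∈T t t>0 with γ t ≤? length ν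
  ... | yes γt≤∣ν∣ =
    subst (λ f → ∃[ s ] (s < t × f ∈ T (γ s))) (sym (take-++ˡ (γ t) ν [ a ] γt≤∣ν∣)) (ν∈T* t t>0)
  ... | no γt≰∣ν∣ = s₀ , ≤-<-trans s₀≤t₀ t₀<t , subst (T (γ s₀)) (sym (take-all (γ t) _ ∣νa∣≤γt)) νa∈T
    where
    ∣ν∣<γt = ≰⇒> γt≰∣ν∣
    t₀<t = increasing⇒<-cancel γ-increasing (≤-<-trans γt₀≤∣ν∣ ∣ν∣<γt)
    ∣νa∣≤γt = ≤-trans (≤-reflexive (trans (length-++ ν) (+-comm _ 1))) ∣ν∣<γt

  T*-noTerminalNodes : NoTerminalNodes T*
  T*-noTerminalNodes ν ν∈T* with increasing-bracket γ-increasing refl (length ν)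
  ... | t₀ , γt₀≤∣ν∣ , ∣ν∣<γ[1+t₀] with ν∈T* (suc t₀) (s≤s z≤n)
  ... | s₀ , s₀<1+t₀ , ν↾∈T =
    map₂ (T*-extend ν∈T* γt₀≤∣ν∣ (≤-pred s₀<1+t₀))
         (squeezed⇒noTerminalNodes (T-squeezed (γ s₀)) ν ν∈T)
    where ν∈T = subst (T (γ s₀)) (take-all _ ν (<⇒≤ ∣ν∣<γ[1+t₀])) ν↾∈T

  T*-squeezed : XSqueezed x T*
  T*-squeezed n = chain⇒squeezed (chainUpTo n (γ n)) T*-noTerminalNodes covers
    where
    covers : Covers (chainUpTo n (γ n)) T*
    covers ν ν∈T* with ν∈T* (suc n) (s≤s z≤n)
    ... | s , s<1+n , ν↾∈T
      with chainUpTo-covers n (increasing⇒≤-mono γ-increasing (≤-pred s<1+n)) _ ν↾∈T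
    ... | e , e∈C , ν↾~e =
      e , e∈C , take-comparable (γ (suc n)) ν e (≤-trans (∈ᶜ⇒length≤span _ e∈C) (span≤γ n)) ν↾~e

lemma7p13 : (x : ℕ → ℕ) → StrictlyIncreasing x → (∀ n → 0 < x n) →
    (T : ℕ → SeqSet) → (∀ n → IsTree (T n)) → (∀ n → XSqueezed x (T n)) →
    Σ SeqSet λ T* → IsTree T* × XSqueezed x T* ×
      Σ (ℕ → ℕ) λ γ → StrictlyIncreasing γ × γ 0 ≡ 0 × (∀ t → 0 < t → t < γ t) ×
        (∀ f → (f ∈ T*) ⇔ (∀ t → 0 < t → ∃[ s ] (s < t × (f ↾ γ t) ∈ T (γ s))))
lemma7p13 x _ _ T T-tree T-squeezed =
  T* , T*-tree , T*-squeezed , γ , γ-increasing , refl , γ-above , λ _ → mk⇔ id id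
  where open Construction x T T-tree T-squeezed
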